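{- Let $\varphi$ be an LTL formula over $V$ with decomposition $\langle\varphi_1,\dots,\varphi_n\rangle$. Let $\mathcal{S}=\langle s_1,\dots,s_n\rangle$ be strategies and $\Psi=\langle\psi_1,\dots,\psi_n\rangle$ LTL certificates for the system processes. If $(\mathcal{S},\Psi)$ is a solution of certifying synthesis for $\varphi$, then $s_1\parallel\cdots\parallel s_n\models\varphi$.
   Context: An architecture consists of an environment process $env$ with output variables $O_{env}$ and $n\ge 2$ system processes $p_1,\dots,p_n$, a finite set $V$ of variables, and for each $p_i$ an input set $I_i\subseteq V$ and output set $O_i\subseteq V$ with $I_i\cap O_i=\emptyset$ and $O_j\cap O_k=\emptyset$ for $j\ne k$. Let $V_i=I_i\cup O_i$, $V=\bigcup_i V_i$, $out=\bigcup_i O_i$. Intersections/unions of words are letterwise. A (Moore) transition system over inputs $I$ and outputs $O$ is $(T,t_0,\tau,o)$ with finite $T$, $\tau:T\times 2^I\to T$, $o:T\to 2^O$; on $\gamma\in(2^I)^\omega$ it visits $t_0t_1\dots$ with $t_{k+1}=\tau(t_k,\gamma_k)$ and produces the trace $(\gamma_0\cup o(t_0))(\gamma_1\cup o(t_1))\dots$. A strategy $s_i$ is a transition system over $I_i,O_i$; $comp(s_i,\gamma)$ is its trace; $s_i\models\chi$ means $comp(s_i,\gamma)\cup\gamma'\models\chi$ for all $\gamma\in(2^{I_i})^\omega,\gamma'\in(2^{V\setminus V_i})^\omega$. The computation of $s_1\parallel\cdots\parallel s_n$ on $\gamma\in(2^{O_{env}})^\omega$ is the unique $\sigma\in(2^V)^\omega$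 with $\sigma\cap O_{env}=\gamma$ and $\sigma\cap O_i=comp(s_i,\sigma\cap I_i)\cap O_i$ for all $i$; $s_1\parallel\cdots\parallel s_n\models\varphi$ means this satisfies $\varphi$ for all $\gamma$. Decomposition: $\varphi=\xi_1\wedge\dots\wedge\xi_k$ with atomic propositions in $V$; $\varphi_i$ is the conjunction of all $\xi_j$ whose atomic propositions intersect $O_i$ or are disjoint from $out$. $(\mathcal{S},\Psi)$, with LTL formulas $\psi_i$ over $V$, is a solution of certifying synthesis for $\varphi$ if for all $i$, $s_i\models\psi_i\wedge(\Psi_i\to\varphi_i)$ where $\Psi_i=\bigwedge_{j\ne i}\psi_j$. -}

module Defs where

open import Data.Nat using (ℕ; zero; suc; _≤_; _<_)
open import Data.Fin using (Fin; _≟_)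
open import Data.Fin.Subset using (Subset; _∈_; _⊆_; _∩_; _∪_; ∁; ⋃; ⁅_⁆)
  renaming (⊥ to ∅)
open import Data.Bool using (Bool; true; false; not; _∨_)
open import Data.Vec using (Vec; []; _∷_)
open import Data.List using (List; []; _∷_; map; filter; filterᵇ; allFin; tabulate)
open import Data.Product using (_×_; Σ; ∃; _,_)
open import Data.Sum using (_⊎_)
open import Data.Unit using (⊤)
open import Data.Empty using (⊥)
open import Relation.Nullary using (¬_; ¬?)
open import Relation.Binary.PropositionalEquality using (_≡_)

-- Variables are Fin m; a letter (element of 2^V) is a subset of V.

Letter : ℕ → Set
Letter m = Subset m

Word : ℕ → Set
Word m = ℕ → Letter m

_∩w_ : ∀ {m} → Word m → Subset m → Word m
(σ ∩w X) k = σ k ∩ X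

_∪w_ : ∀ {m} → Word m → Word m → Word m
(σ ∪w ρ) k = σ k ∪ ρ k

WordOver : ∀ {m} → Subset m → Word m → Set
WordOver X γ = ∀ k → γ k ⊆ X

data LTL (m : ℕ) : Set where
  tt ff   : LTL m
  atom    : Fin m → LTL m
  ¬ₗ_     : LTL m → LTL m
  _∧ₗ_ _∨ₗ_ _⇒ₗ_ : LTL m → LTL m → LTL m
  Xₗ_ Fₗ_ Gₗ_ : LTL m → LTL m
  _Uₗ_ _Rₗ_ : LTL m → LTL m → LTL m

Sat : ∀ {m} → Word m → ℕ → LTL m → Set
Sat σ k tt = ⊤
Sat σ k ff = ⊥
Sat σ k (atom v) = v ∈ σ k
Sat σ k (¬ₗ φ) = ¬ Sat σ k φ
Sat σ k (φ ∧ₗ ψ) = Sat σ k φ × Sat σ k ψ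
Sat σ k (φ ∨ₗ ψ) = Sat σ k φ ⊎ Sat σ k ψ
Sat σ k (φ ⇒ₗ ψ) = Sat σ k φ → Sat σ k ψ
Sat σ k (Xₗ φ) = Sat σ (suc k) φ
Sat σ k (Fₗ φ) = ∃ λ j → k ≤ j × Sat σ j φ
Sat σ k (Gₗ φ) = ∀ j → k ≤ j → Sat σ j φ
Sat σ k (φ Uₗ ψ) = ∃ λ j → k ≤ j × Sat σ j ψ × (∀ i → k ≤ i → i < j → Sat σ i φ)
Sat σ k (φ Rₗ ψ) = ∀ j → k ≤ j → Sat σ j ψ ⊎ (∃ λ i → k ≤ i × i < j × Sat σ i φ)

_⊨_ : ∀ {m} → Word m → LTL m → Set
σ ⊨ φ = Sat σ 0 φ

atoms : ∀ {m} → LTL m → Subset m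
atoms tt = ∅
atoms ff = ∅
atoms (atom v) = ⁅ v ⁆
atoms (¬ₗ φ) = atoms φ
atoms (φ ∧ₗ ψ) = atoms φ ∪ atoms ψ
atoms (φ ∨ₗ ψ) = atoms φ ∪ atoms ψ
atoms (φ ⇒ₗ ψ) = atoms φ ∪ atoms ψ
atoms (Xₗ φ) = atoms φ
atoms (Fₗ φ) = atoms φ
atoms (Gₗ φ) = atoms φ
atoms (φ Uₗ ψ) = atoms φ ∪ atoms ψ
atoms (φ Rₗ ψ) = atoms φ ∪ atoms ψ

⋀ : ∀ {m} → List (LTL m) → LTL m
⋀ [] = tt
⋀ (ξ ∷ ξs) = ξ ∧ₗ ⋀ ξs

nonemptyᵇ : ∀ {m} → Subset m → Bool
nonemptyᵇ [] = false
nonemptyᵇ (b ∷ p) = b ∨ nonemptyᵇ p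

record Architecture : Set where
  field
    m     : ℕ                      -- number of variables, V = Fin m
    n     : ℕ                      -- number of system processes
    2≤n   : 2 ≤ n
    Oenv  : Subset m
    I     : Fin n → Subset m
    O     : Fin n → Subset m
    I∩O≡∅ : ∀ i → I i ∩ O i ≡ ∅
    O-disj : ∀ j k → ¬ (j ≡ k) → O j ∩ O k ≡ ∅
    V-cover : ∀ (v : Fin m) → ∃ λ i → v ∈ (I i ∪ O i)

  Vᵢ : Fin n → Subset m
  Vᵢ i = I i ∪ O i

  out : Subset m
  out = ⋃ (tabulate O)

-- Moore transition systems over inputs I and outputs O (subsets of V).
-- τ is given on all letters; only letters ⊆ I are ever fed to it, so this
-- is the same as τ : T × 2^I → T.

record TS {m : ℕ} (I O : Subset m) : Set where
  field
    size : ℕ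
    t₀   : Fin size
    τ    : Fin size → Letter m → Fin size
    o    : Fin size → Letter m
    o⊆O  : ∀ t → o t ⊆ O

  run : Word m → ℕ → Fin size
  run γ zero = t₀
  run γ (suc k) = τ (run γ k) (γ k)

  comp : Word m → Word m
  comp γ k = γ k ∪ o (run γ k)

open TS public

module _ (A : Architecture) where
  open Architecture A

  Strategy : Fin n → Set
  Strategy i = TS (I i) (O i)

  _⊨ₛ_ : ∀ {i} → Strategy i → LTL m → Set
  _⊨ₛ_ {i} s χ = ∀ (γ γ' : Word m) → WordOver (I i) γ → WordOver (∁ (Vᵢ i)) γ' →
                 (comp s γ ∪w γ') ⊨ χ

  IsComputation : (Strategies : (i : Fin n) → Strategy i) → Word m → Word m → Set
  IsComputation S γ σ = (∀ k → σ k ∩ Oenv ≡ γ k)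
                      × (∀ i k → σ k ∩ O i ≡ comp (S i) (σ ∩w I i) k ∩ O i)

  _⊨∥_ : (S : (i : Fin n) → Strategy i) → LTL m → Set
  S ⊨∥ φ = ∀ (γ σ : Word m) → WordOver Oenv γ → IsComputation S γ σ → σ ⊨ φ

  -- decomposition: φ = ⋀ ξs; φ_i = conjunction of ξ_j with
  -- atoms(ξ_j) ∩ O_i ≠ ∅ or atoms(ξ_j) ∩ out = ∅
  relevant : Fin n → LTL m → Bool
  relevant i ξ = nonemptyᵇ (atoms ξ ∩ O i) ∨ not (nonemptyᵇ (atoms ξ ∩ out))

  φᵢ : List (LTL m) → Fin n → LTL m
  φᵢ ξs i = ⋀ (filterᵇ (relevant i) ξs)

  Ψᵢ : (Fin n → LTL m) → Fin n → LTL m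
  Ψᵢ ψ i = ⋀ (map ψ (filter (λ j → ¬? (j ≟ i)) (allFin n)))

  IsCertSolution : List (LTL m) → ((i : Fin n) → Strategy i) → (Fin n → LTL m) → Set
  IsCertSolution ξs S ψ = ∀ i → S i ⊨ₛ (ψ i ∧ₗ (Ψᵢ ψ i ⇒ₗ φᵢ ξs i))

{-# OPTIONS --safe #-}
-- A word σ that is the computation of the composed system agrees with each
-- s_i on O_i, so σ is exactly the trace of s_i on σ ∩ I_i padded with
-- σ ∩ ∁V_i; hence every guarantee s_i ⊨ χ holds of σ. In particular σ
-- satisfies every certificate ψ_j, so all the assumptions Ψ_i hold, hence
-- every φ_i; and every conjunct ξ of φ occurs in some φ_i (in that of a
-- process owning one of its outputs, or in all of them if ξ mentions none).
module Submission where

open import Defs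
open import Data.Nat using (s≤s; z≤n)
open import Data.Nat.Properties using (≤-trans)
open import Data.Fin using (Fin; zero; suc; _≟_; fromℕ<)
open import Data.Fin.Subset using (Subset; _∈_; _⊆_; _∩_; _∪_; ∁; ⋃; Nonempty; inside; outside)
open import Data.Fin.Subset.Properties
open import Data.Bool using (Bool; true; false; T)
open import Data.Bool.Properties using (T-∨; T-≡; T?)
open import Data.Vec using (_∷_; here; there)
open import Data.List using (List; []; _∷_; filter; filterᵇ; allFin)
open import Data.List.Relation.Unary.All as All using (All; []; _∷_)
open import Data.List.Relation.Unary.All.Properties as All using ()
open import Data.List.Relation.Unary.Any as Any using (Any)
open import Data.List.Relation.Unary.Any.Properties as Any using ()
open import Data.List.Membership.Propositional.Properties using (∈-filter⁺)
open import Data.Product using (∃; _,_; proj₁; proj₂)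
open import Data.Sum using (inj₁; inj₂; [_,_])
open import Data.Unit using (tt)
open import Data.Empty using (⊥-elim)
open import Function using (_∘_)
open import Function.Bundles using (Equivalence)
open import Relation.Nullary using (¬?; yes; no)
open import Relation.Binary.PropositionalEquality using (_≡_; _≗_; sym; subst)

open Equivalence using (from)

Sat-resp-≗ : ∀ {m} {σ σ' : Word m} → σ ≗ σ' → ∀ k φ → Sat σ k φ → Sat σ' k φ
Sat-resp-≗ e k tt s = s
Sat-resp-≗ e k ff s = s
Sat-resp-≗ e k (atom v) s = subst (v ∈_) (e k) s
Sat-resp-≗ e k (¬ₗ φ) s = λ s' → s (Sat-resp-≗ (λ j → sym (e j)) k φ s')
Sat-resp-≗ e k (φ ∧ₗ ψ) (a , b) = Sat-resp-≗ e k φ a , Sat-resp-≗ e k ψ b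
Sat-resp-≗ e k (φ ∨ₗ ψ) (inj₁ a) = inj₁ (Sat-resp-≗ e k φ a)
Sat-resp-≗ e k (φ ∨ₗ ψ) (inj₂ b) = inj₂ (Sat-resp-≗ e k ψ b)
Sat-resp-≗ e k (φ ⇒ₗ ψ) s = λ a → Sat-resp-≗ e k ψ (s (Sat-resp-≗ (λ j → sym (e j)) k φ a))
Sat-resp-≗ e k (Xₗ φ) s = Sat-resp-≗ e _ φ s
Sat-resp-≗ e k (Fₗ φ) (j , k≤j , s) = j , k≤j , Sat-resp-≗ e j φ s
Sat-resp-≗ e k (Gₗ φ) s = λ j k≤j → Sat-resp-≗ e j φ (s j k≤j)
Sat-resp-≗ e k (φ Uₗ ψ) (j , k≤j , s , before) =
  j , k≤j , Sat-resp-≗ e j ψ s , λ i k≤i i<j → Sat-resp-≗ e i φ (before i k≤i i<j)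
Sat-resp-≗ e k (φ Rₗ ψ) s j k≤j with s j k≤j
... | inj₁ x = inj₁ (Sat-resp-≗ e j ψ x)
... | inj₂ (i , k≤i , i<j , x) = inj₂ (i , k≤i , i<j , Sat-resp-≗ e i φ x)

⊨⋀⁺ : ∀ {m} {σ : Word m} {ξs : List (LTL m)} → All (σ ⊨_) ξs → σ ⊨ ⋀ ξs
⊨⋀⁺ [] = tt
⊨⋀⁺ (s ∷ ss) = s , ⊨⋀⁺ ss

⊨⋀⁻ : ∀ {m} {σ : Word m} (ξs : List (LTL m)) → σ ⊨ ⋀ ξs → All (σ ⊨_) ξs
⊨⋀⁻ [] tt = []
⊨⋀⁻ (ξ ∷ ξs) (s , ss) = s ∷ ⊨⋀⁻ ξs ss

⊨⋀-filterᵇ-cover : ∀ {m k} {σ : Word m} (keep : Fin k → LTL m → Bool) (ξs : List (LTL m)) →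
                   (∀ ξ → ∃ λ i → T (keep i ξ)) →
                   (∀ i → σ ⊨ ⋀ (filterᵇ (keep i) ξs)) → σ ⊨ ⋀ ξs
⊨⋀-filterᵇ-cover keep ξs cover sat = ⊨⋀⁺ {ξs = ξs} (All.tabulate λ {ξ} ξ∈ξs →
  let (i , kept) = cover ξ in
  All.lookup (⊨⋀⁻ _ (sat i)) (∈-filter⁺ (T? ∘ keep i) ξ∈ξs kept))

nonemptyᵇ⁺ : ∀ {m} {p : Subset m} → Nonempty p → T (nonemptyᵇ p)
nonemptyᵇ⁺ {p = inside ∷ p} _ = tt
nonemptyᵇ⁺ {p = outside ∷ p} (suc x , there x∈p) = nonemptyᵇ⁺ (x , x∈p)

nonemptyᵇ⁻ : ∀ {m} (p : Subset m) → T (nonemptyᵇ p) → Nonempty p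
nonemptyᵇ⁻ (inside ∷ p) _ = zero , here
nonemptyᵇ⁻ (outside ∷ p) t with nonemptyᵇ⁻ p t
... | x , x∈p = suc x , there x∈p

x∈⋃⁻ : ∀ {m} {x : Fin m} (ps : List (Subset m)) → x ∈ ⋃ ps → Any (x ∈_) ps
x∈⋃⁻ [] x∈∅ = ⊥-elim (∉⊥ x∈∅)
x∈⋃⁻ (p ∷ ps) x∈p∪⋃ps with x∈p∪q⁻ p (⋃ ps) x∈p∪⋃ps
... | inj₁ x∈p = Any.here x∈p
... | inj₂ x∈⋃ps = Any.there (x∈⋃⁻ ps x∈⋃ps)

reassemble : ∀ {m} {σ I O o : Subset m} → o ⊆ O → σ ∩ O ≡ (σ ∩ I ∪ o) ∩ O →
             (σ ∩ I ∪ o) ∪ σ ∩ ∁ (I ∪ O) ≡ σ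
reassemble {σ = σ} {I} {O} {o} o⊆O agree = ⊆-antisym ⊆σ σ⊆
  where
  ⊆σ : (σ ∩ I ∪ o) ∪ σ ∩ ∁ (I ∪ O) ⊆ σ
  ⊆σ {x} x∈ with x∈p∪q⁻ (σ ∩ I ∪ o) _ x∈
  ... | inj₂ x∈rest = p∩q⊆p _ _ x∈rest
  ... | inj₁ x∈local with x∈p∪q⁻ (σ ∩ I) o x∈local
  ...   | inj₁ x∈σ∩I = p∩q⊆p _ _ x∈σ∩I
  ...   | inj₂ x∈o = p∩q⊆p _ _ (subst (x ∈_) (sym agree) (x∈p∩q⁺ (x∈local , o⊆O x∈o)))
  σ⊆ : σ ⊆ (σ ∩ I ∪ o) ∪ σ ∩ ∁ (I ∪ O)
  σ⊆ {x} x∈σ with x ∈? I | x ∈? O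
  ... | yes x∈I | _ = p⊆p∪q _ (p⊆p∪q _ (x∈p∩q⁺ (x∈σ , x∈I)))
  ... | no _ | yes x∈O = p⊆p∪q _ (p∩q⊆p _ _ (subst (x ∈_) agree (x∈p∩q⁺ (x∈σ , x∈O))))
  ... | no x∉I | no x∉O =
    q⊆p∪q _ _ (x∈p∩q⁺ (x∈σ , x∉p⇒x∈∁p λ x∈I∪O → [ x∉I , x∉O ] (x∈p∪q⁻ I O x∈I∪O)))

module _ (A : Architecture) where
  open Architecture A

  relevant-somewhere : ∀ ξ → ∃ λ i → T (relevant A i ξ)
  relevant-somewhere ξ with nonemptyᵇ (atoms ξ ∩ out) in shared
  -- ξ mentions no output, so every process keeps it; 2 ≤ n just supplies one.
  ... | false = i₀ , from (T-∨ {nonemptyᵇ (atoms ξ ∩ O i₀)}) (inj₂ tt)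
    where
    i₀ : Fin n
    i₀ = fromℕ< (≤-trans (s≤s z≤n) 2≤n)
  ... | true with nonemptyᵇ⁻ _ (from T-≡ shared)
  ...   | x , x∈atoms∩out with x∈p∩q⁻ (atoms ξ) out x∈atoms∩out
  ...     | x∈atoms , x∈out with Any.tabulate⁻ (x∈⋃⁻ _ x∈out)
  ...       | i , x∈Oᵢ = i , from T-∨ (inj₁ (nonemptyᵇ⁺ (x , x∈p∩q⁺ (x∈atoms , x∈Oᵢ))))

  module _ (S : (i : Fin n) → Strategy A i) (σ : Word m) (i : Fin n)
           (agree : ∀ k → σ k ∩ O i ≡ comp (S i) (σ ∩w I i) k ∩ O i) where

    local-view : comp (S i) (σ ∩w I i) ∪w (σ ∩w ∁ (Vᵢ i)) ≗ σ
    local-view k = reassemble (o⊆O (S i) _) (agree k)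

    ⊨ₛ⇒⊨ : ∀ χ → _⊨ₛ_ A (S i) χ → σ ⊨ χ
    ⊨ₛ⇒⊨ χ s⊨χ = Sat-resp-≗ local-view 0 χ
      (s⊨χ (σ ∩w I i) (σ ∩w ∁ (Vᵢ i)) (λ _ → p∩q⊆q _ _) (λ _ → p∩q⊆q _ _))

lemma3 : (A : Architecture) → let open Architecture A in
         (ξs : List (LTL m)) (S : (i : Fin n) → Strategy A i) (ψ : Fin n → LTL m) →
         IsCertSolution A ξs S ψ → _⊨∥_ A S (⋀ ξs)
lemma3 A ξs S ψ cert _ σ _ (_ , agree) =
  ⊨⋀-filterᵇ-cover (relevant A) ξs (relevant-somewhere A) σ⊨φᵢ
  where
  open Architecture A

  σ⊨contract : ∀ i → σ ⊨ (ψ i ∧ₗ (Ψᵢ A ψ i ⇒ₗ φᵢ A ξs i))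
  σ⊨contract i = ⊨ₛ⇒⊨ A S σ i (agree i) (ψ i ∧ₗ (Ψᵢ A ψ i ⇒ₗ φᵢ A ξs i)) (cert i)

  σ⊨φᵢ : ∀ i → σ ⊨ φᵢ A ξs i
  σ⊨φᵢ i = proj₂ (σ⊨contract i)
    (⊨⋀⁺ (All.map⁺ (All.universal (proj₁ ∘ σ⊨contract) (filter (λ j → ¬? (j ≟ i)) (allFin n)))))
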